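{- Let $n$ be a positive integer, let $S\subseteq\mathbb{Z}_n$ with $S=-S$ and $0\notin S$, let $\Gamma=\mathrm{Cay}(\mathbb{Z}_n,S)$, and let $H\le\mathbb{Z}_n$ be a subgroup such that $\gcd\bigl(|H|,\,n/|H|\bigr)=1$. Then the pair $(\Gamma,H)$ satisfies the replacement property.
   Context: $\mathrm{Cay}(\mathbb{Z}_n,S)$ is the graph with vertex set $\mathbb{Z}_n$ in which $x,y$ are adjacent iff $y-x\in S$. For $g\in\mathbb{Z}_n$ let $g_r:\mathbb{Z}_n\to\mathbb{Z}_n$, $x\mapsto x+g$. Let $\mathcal{H}=\{H+g\mid g\in\mathbb{Z}_n\}$ be the partition of $\mathbb{Z}_n$ into cosets of $H$, and let $\mathrm{Aut}_{\mathcal H}(\Gamma)$ be the group of graph automorphisms $\sigma$ of $\Gamma$ with $\sigma[\mathfrak h]=\mathfrak h$ for every $\mathfrak h\in\mathcal H$. The pair $(\Gamma,H)$ satisfies the replacement property if there exists a function $f:\mathcal H\to\mathbb{Z}_n$ with $f(H)=0$ such that for every $\sigma\in\mathrm{Aut}_{\mathcal H}(\Gamma)$ there exists $\widetilde\sigma\in\mathrm{Aut}_{\mathcal H}(\Gamma)$ with $\widetilde\sigma|_{\mathfrak h}=f(\mathfrak h)_r\circ\sigma|_H\circ f(\mathfrak h)_r^{ -1}$ for every $\mathfrak h\in\mathcal H$ (an equality of maps with domain $\mathfrak h$; so $f(\mathfrak h)\in\mathfrak h$ and $\widetilde\sigma(x)=\sigma(x-f(\mathfrak h))+f(\mathfrak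 h)$ for $x\in\mathfrak h$). -}

module Defs where

open import Data.Nat using (ℕ; zero; suc; _+_; _∸_; NonZero; _%_; _/_)
open import Data.Nat.DivMod using (m%n<n)
open import Data.Nat.GCD using (gcd)
open import Data.Fin using (Fin; toℕ; fromℕ<)
open import Data.Fin.Subset using (Subset; _∈_; _∉_; ∣_∣; inside; outside)
open import Data.Fin.Subset.Properties using ()
open import Data.Fin.Permutation using (Permutation′; _⟨$⟩ʳ_)
open import Data.Vec using (_∷_)
open import Data.Vec.Base using (there)
open import Data.Product using (Σ; _×_; ∃; ∃-syntax)
open import Relation.Binary.PropositionalEquality using (_≡_; refl)
open import Function.Bundles using (_⇔_)

module Zn (n : ℕ) .{{_ : NonZero n}} where

  ℤₙ : Set
  ℤₙ = Fin n

  𝟘 : ℤₙ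
  𝟘 = fromℕ< (m%n<n 0 n)

  infixl 6 _⊕_ _⊖_
  _⊕_ : ℤₙ → ℤₙ → ℤₙ
  x ⊕ y = fromℕ< (m%n<n (toℕ x + toℕ y) n)

  ⊝_ : ℤₙ → ℤₙ
  ⊝ x = fromℕ< (m%n<n (n ∸ toℕ x) n)

  _⊖_ : ℤₙ → ℤₙ → ℤₙ
  x ⊖ y = x ⊕ (⊝ y)

  _ʳ : ℤₙ → ℤₙ → ℤₙ
  (g ʳ) x = x ⊕ g

  record IsSubgroup (H : Subset n) : Set where
    field
      𝟘∈H : 𝟘 ∈ H
      ⊕-closed : ∀ {x y} → x ∈ H → y ∈ H → x ⊕ y ∈ H
      ⊝-closed : ∀ {x} → x ∈ H → ⊝ x ∈ H

  Adj : Subset n → ℤₙ → ℤₙ → Set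
  Adj S x y = (y ⊖ x) ∈ S

  _∈Coset_+_ : ℤₙ → Subset n → ℤₙ → Set
  x ∈Coset H + g = (x ⊖ g) ∈ H

  IsAut : Subset n → Permutation′ n → Set
  IsAut S σ = ∀ x y → Adj S x y ⇔ Adj S (σ ⟨$⟩ʳ x) (σ ⟨$⟩ʳ y)

  FixesCosets : Subset n → Permutation′ n → Set
  FixesCosets H σ = ∀ g →
    (∀ x → x ∈Coset H + g → (σ ⟨$⟩ʳ x) ∈Coset H + g) ×
    (∀ y → y ∈Coset H + g → ∃[ x ] (x ∈Coset H + g × σ ⟨$⟩ʳ x ≡ y))

  IsAutℋ : Subset n → Subset n → Permutation′ n → Set
  IsAutℋ S H σ = IsAut S σ × FixesCosets H σ

  -- A function f : 𝓗 → ℤ_n, given on representatives g of cosets H+g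
  -- (well defined on cosets), with f(H) = 0 and f(H+g) ∈ H+g.
  record CosetFun (H : Subset n) : Set where
    field
      f : ℤₙ → ℤₙ
      well-defined : ∀ g g′ → g′ ∈Coset H + g → f g ≡ f g′
      f-H : f 𝟘 ≡ 𝟘
      f-in : ∀ g → f g ∈Coset H + g
  open CosetFun public

  ReplacementProperty : Subset n → Subset n → Set
  ReplacementProperty S H =
    Σ (CosetFun H) λ F →
      ∀ σ → IsAutℋ S H σ →
        ∃[ σ~ ] (IsAutℋ S H σ~ ×
          (∀ g x → x ∈Coset H + g →
             σ~ ⟨$⟩ʳ x ≡ (f F g ʳ) (σ ⟨$⟩ʳ (x ⊖ f F g))))

∈⇒NonZero : ∀ {m} {x : Fin m} {p : Subset m} → x ∈ p → NonZero ∣ p ∣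
∈⇒NonZero {p = inside ∷ p} _ = _
∈⇒NonZero {p = outside ∷ p} (there x∈p) = ∈⇒NonZero x∈p

module _ (n : ℕ) .{{_ : NonZero n}} where
  open Zn n
  index : (H : Subset n) → IsSubgroup H → ℕ
  index H sg = _/_ n ∣ H ∣ {{∈⇒NonZero (IsSubgroup.𝟘∈H sg)}}

-- Write n = m · k with H = kℤₙ of order m. By hypothesis gcd m k = 1, so mℤₙ meets every coset of H in
-- exactly one point, which f picks (f g = (g mod k) · ε for some ε ∈ mℤₙ with ε ≡ 1 mod k). For σ ∈ Aut_𝓗(Γ)
-- put σ̃ x = σ (x − f x) + f x. Between the cosets of a, b ∈ mℤₙ, with δ = b − a and T = S ∩ (δ + H),
-- σ̃ preserves the arcs as soon as σ y and σ (y + δ) − δ have the same in-neighbours in Cay(ℤₙ, T) for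
-- every y. The translations e with this property form a subgroup; it contains k δ = 0, and for every
-- prime p ∤ m and m ∣ p^f − 1 it contains (p^f − 1) δ: modulo p, the p^f-th convolution power of the
-- indicator of T, which σ preserves as a function of differences, is the indicator of T shifted by
-- (p^f − 1) δ, because p^f t = t + (p^f − 1) δ on T. A gcd descent over the primes dividing k reaches δ.

module Submission where

open import Defs
open import Data.Nat
  using (ℕ; zero; suc; z<s; s<s; _+_; _*_; _∸_; _^_; _%_; _/_; _<_; _≤_; _!;
         NonZero; >-nonZero; ≢-nonZero; ≢-nonZero⁻¹; nonTrivial⇒n>1)
open import Data.Nat.Properties
open import Data.Nat.DivMod
open import Data.Nat.Divisibility
open import Data.Nat.GCD using (gcd; gcd[m,n]∣m; gcd[m,n]∣n; gcd-GCD; module Bézout)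
open import Data.Nat.Coprimality as Coprimality using (Coprime; coprime-divisor)
open import Data.Nat.Primality using (Prime; euclidsLemma; ¬prime[1]; prime⇒nonZero; prime⇒nonTrivial)
open import Data.Nat.Primality.Factorisation using (factorise)
open import Data.Nat.Combinatorics using (_C_; nCk≡n!/k![n-k]!; k![n∸k]!∣n!; nCn≡1)
open import Data.Nat.Induction using (<-rec)
open import Data.Nat.ListAction using (product)
import Data.List as List
open import Data.List.Relation.Unary.All as All using ()
open import Data.Bool using (if_then_else_)
open import Data.Fin as Fin using (Fin; toℕ; fromℕ<; fromℕ; inject₁)
open import Data.Fin.Properties using (pigeonhole; toℕ-fromℕ<; toℕ-fromℕ; toℕ-inject₁; toℕ-injective; toℕ<n; any?)
open import Data.Fin.Permutation using (Permutation′; permutation; _⟨$⟩ʳ_; _⟨$⟩ˡ_; inverseˡ; inverseʳ)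
open import Data.Fin.Subset using (Subset; _∈_; _∉_; ∣_∣; inside; outside)
open import Data.Fin.Subset.Properties using (_∈?_)
open import Data.Vec using ([]; _∷_)
open import Data.Vec.Functional using (Vector)
open import Data.Product using (_×_; _,_; proj₁; proj₂; ∃-syntax)
open import Data.Product.Function.NonDependent.Propositional using (_×-⇔_)
open import Data.Sum using (_⊎_; inj₁; inj₂)
open import Function using (_∘_)
open import Function.Bundles using (_⇔_; mk⇔; Equivalence)
open import Function.Construct.Composition using (_⇔-∘_)
open import Function.Construct.Identity using (⇔-id)
open import Function.Construct.Symmetry using (⇔-sym)
open import Function.Properties.Equivalence using (⇔-setoid)
open import Level using (0ℓ)
open import Algebra.Bundles using (AbelianGroup; CommutativeSemiring)
open import Algebra.Structures using (IsAbelianGroup; IsCommutativeSemiring)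
open import Algebra.Structures.Biased using (isCommutativeSemiringˡ; isCommutativeMonoidˡ)
open import Algebra.Properties.Semiring.Sum +-*-semiring
  using (sum; sum-cong-≗; sum-replicate-zero; sum-permute; ∑-comm; ∑-distrib-+; *-distribˡ-sum; *-distribʳ-sum)
open import Relation.Binary.Structures using (IsEquivalence)
open import Relation.Binary.PropositionalEquality
  using (_≡_; refl; sym; trans; cong; cong₂; subst; subst₂; isEquivalence; module ≡-Reasoning)
open import Relation.Nullary using (¬_; ¬?; Dec; yes; no; does; contradiction)
open import Relation.Nullary.Decidable using (_×-dec_; decidable-stable)
open import Relation.Unary using (Decidable)

private
  variable
    a b c d j k m p : ℕ

𝟙 : ∀ {ℓ} {P : Set ℓ} → Dec P → ℕ
𝟙 P? = if does P? then 1 else 0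

𝟙-yes : ∀ {ℓ} {P : Set ℓ} (P? : Dec P) → P → 𝟙 P? ≡ 1
𝟙-yes (yes _) _ = refl
𝟙-yes (no ¬p) p = contradiction p ¬p

𝟙-no : ∀ {ℓ} {P : Set ℓ} (P? : Dec P) → ¬ P → 𝟙 P? ≡ 0
𝟙-no (yes p) ¬p = contradiction p ¬p
𝟙-no (no _)  _  = refl

module _ {ℓ₁ ℓ₂} {P : Set ℓ₁} {Q : Set ℓ₂} where

  𝟙-cong : (P? : Dec P) (Q? : Dec Q) → P ⇔ Q → 𝟙 P? ≡ 𝟙 Q?
  𝟙-cong (yes _) (yes _) _ = refl
  𝟙-cong (no _)  (no _)  _ = refl
  𝟙-cong (yes p) (no ¬q) P⇔Q = contradiction (Equivalence.to P⇔Q p) ¬q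
  𝟙-cong (no ¬p) (yes q) P⇔Q = contradiction (Equivalence.from P⇔Q q) ¬p

  𝟙-injective : (P? : Dec P) (Q? : Dec Q) → 𝟙 P? ≡ 𝟙 Q? → P ⇔ Q
  𝟙-injective (yes p) (yes q) _ = mk⇔ (λ _ → q) (λ _ → p)
  𝟙-injective (no ¬p) (no ¬q) _ = mk⇔ (λ p → contradiction p ¬p) (λ q → contradiction q ¬q)

  𝟙-%-injective : ∀ {q} .{{_ : NonZero q}} → 1 < q →
                  (P? : Dec P) (Q? : Dec Q) → 𝟙 P? % q ≡ 𝟙 Q? % q → P ⇔ Q
  𝟙-%-injective {q} 1<q P? Q? P?≡Q? = 𝟙-injective P? Q? (trans (sym (𝟙%q≡𝟙 P?)) (trans P?≡Q? (𝟙%q≡𝟙 Q?)))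
    where
    𝟙%q≡𝟙 : ∀ {ℓ} {R : Set ℓ} (R? : Dec R) → 𝟙 R? % q ≡ 𝟙 R?
    𝟙%q≡𝟙 (yes _) = m<n⇒m%n≡m 1<q
    𝟙%q≡𝟙 (no _)  = m<n⇒m%n≡m (<-trans z<s 1<q)

prime∤1 : Prime p → ¬ p ∣ 1
prime∤1 p-prime p∣1 = ¬prime[1] (subst Prime (∣1⇒≡1 p∣1) p-prime)

prime∤! : Prime p → j < p → ¬ p ∣ j !
prime∤! {j = zero}  p-prime _   = prime∤1 p-prime
prime∤! {j = suc j} p-prime j<p p∣j! with euclidsLemma (suc j) (j !) p-prime p∣j!
... | inj₁ p∣1+j = <⇒≱ j<p (∣⇒≤ p∣1+j)
... | inj₂ p∣j!  = prime∤! p-prime (<-trans (n<1+n j) j<p) p∣j!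

nCk*k!*[n∸k]!≡n! : ∀ {n k} → k ≤ n → (n C k) * (k ! * (n ∸ k) !) ≡ n !
nCk*k!*[n∸k]!≡n! {n} {k} k≤n =
  trans (cong (_* (k ! * (n ∸ k) !)) (nCk≡n!/k![n-k]! k≤n)) (m/n*n≡m (k![n∸k]!∣n! k≤n))
  where instance _ = k !* (n ∸ k) !≢0

prime∣pCk : Prime p → 0 < k → k < p → p ∣ p C k
prime∣pCk {p@(suc p′)} {k} p-prime 0<k k<p
  with euclidsLemma (p C k) (k ! * (p ∸ k) !) p-prime
         (subst (p ∣_) (sym (nCk*k!*[n∸k]!≡n! (<⇒≤ k<p))) (m∣m*n (p′ !)))
... | inj₁ p∣pCk = p∣pCk
... | inj₂ p∣k!*[p∸k]! with euclidsLemma (k !) ((p ∸ k) !) p-prime p∣k!*[p∸k]!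
...   | inj₁ p∣k!     = contradiction p∣k! (prime∤! p-prime k<p)
...   | inj₂ p∣[p∸k]! = contradiction p∣[p∸k]! (prime∤! p-prime (∸-monoʳ-< 0<k (<⇒≤ k<p)))

∃-prime-divisor : 1 < j → ∃[ p ] Prime p × p ∣ j
∃-prime-divisor {j} 1<j with factorise j {{>-nonZero (<-trans z<s 1<j)}}
... | record { factors = List.[] ; isFactorisation = j≡1 } = contradiction j≡1 (>⇒≢ 1<j)
... | record { factors = p List.∷ ps ; isFactorisation = j≡p*ps ; factorsPrime = p-prime All.∷ _ } =
  p , p-prime , subst (p ∣_) (sym j≡p*ps) (m∣m*n (product ps))

m∣m^n : ∀ {m n} → 0 < n → m ∣ m ^ n
m∣m^n {m} {suc n} _ = m∣m*n (m ^ n)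

%≡%⇒∣∸ : ∀ {m} .{{_ : NonZero m}} {a b} → a % m ≡ b % m → m ∣ b ∸ a
%≡%⇒∣∸ {m} {a} {b} a≡b = divides (b / m ∸ a / m) (begin
  b ∸ a                                     ≡⟨ cong₂ _∸_ (m≡m%n+[m/n]*n b m) (m≡m%n+[m/n]*n a m) ⟩
  (b % m + b / m * m) ∸ (a % m + a / m * m) ≡⟨ cong (λ r → (b % m + b / m * m) ∸ (r + a / m * m)) a≡b ⟩
  (b % m + b / m * m) ∸ (b % m + a / m * m) ≡⟨ [m+n]∸[m+o]≡n∸o (b % m) _ _ ⟩
  b / m * m ∸ a / m * m                     ≡⟨ *-distribʳ-∸ m (b / m) (a / m) ⟨
  (b / m ∸ a / m) * m                       ∎)
  where open ≡-Reasoning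

coprime-^-divisor : Coprime m p → m ∣ p ^ a * b → m ∣ b
coprime-^-divisor {m} {a = zero}  _   m∣1*b = subst (m ∣_) (+-identityʳ _) m∣1*b
coprime-^-divisor {m} {p} {a = suc a} {b} m⊥p m∣pᵃ⁺¹*b =
  coprime-^-divisor {a = a} m⊥p (coprime-divisor m⊥p (subst (m ∣_) (*-assoc p (p ^ a) b) m∣pᵃ⁺¹*b))

-- The powers of p cannot all be distinct modulo m, and p is cancellable modulo m.
∃-^≡1-mod : .{{_ : NonZero m}} → Coprime m p → ∃[ f ] 0 < f × m ∣ p ^ f ∸ 1
∃-^≡1-mod {m} {p} m⊥p
  with pigeonhole (n<1+n m) (λ (i : Fin (suc m)) → fromℕ< (m%n<n (p ^ toℕ i) m))
... | i , j , i<j , pⁱ≡pʲ =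
  toℕ j ∸ toℕ i , m<n⇒0<n∸m i<j ,
  coprime-^-divisor {a = toℕ i} m⊥p (subst (m ∣_) pʲ∸pⁱ≡pⁱ*[pʲ⁻ⁱ∸1] (%≡%⇒∣∸ pⁱ%m≡pʲ%m))
  where
  pⁱ%m≡pʲ%m : p ^ toℕ i % m ≡ p ^ toℕ j % m
  pⁱ%m≡pʲ%m = trans (sym (toℕ-fromℕ< _)) (trans (cong toℕ pⁱ≡pʲ) (toℕ-fromℕ< _))
  pʲ∸pⁱ≡pⁱ*[pʲ⁻ⁱ∸1] : p ^ toℕ j ∸ p ^ toℕ i ≡ p ^ toℕ i * (p ^ (toℕ j ∸ toℕ i) ∸ 1)
  pʲ∸pⁱ≡pⁱ*[pʲ⁻ⁱ∸1] = begin
    p ^ toℕ j ∸ p ^ toℕ i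
      ≡⟨ cong (λ e → p ^ e ∸ p ^ toℕ i) (m+[n∸m]≡n (<⇒≤ i<j)) ⟨
    p ^ (toℕ i + (toℕ j ∸ toℕ i)) ∸ p ^ toℕ i
      ≡⟨ cong₂ _∸_ (^-distribˡ-+-* p (toℕ i) _) (sym (*-identityʳ (p ^ toℕ i))) ⟩
    p ^ toℕ i * p ^ (toℕ j ∸ toℕ i) ∸ p ^ toℕ i * 1
      ≡⟨ *-distribˡ-∸ (p ^ toℕ i) _ 1 ⟨
    p ^ toℕ i * (p ^ (toℕ j ∸ toℕ i) ∸ 1)
      ∎
    where open ≡-Reasoning

-- Repeatedly replacing j by gcd j i with i ∈ P, j ∤ i, strictly decreases j.
gcd-descent : ∀ {ℓ₁ ℓ₂} {P : ℕ → Set ℓ₁} {Q : ℕ → Set ℓ₂} {j₀} .{{_ : NonZero j₀}} →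
              (∀ {i j} → P i → P j → P (gcd i j)) →
              (∀ {j} → j ∣ j₀ → P j → Q j ⊎ ∃[ i ] P i × ¬ j ∣ i) →
              P j₀ → ∃[ d ] d ∣ j₀ × P d × Q d
gcd-descent {P = P} {Q} {j₀} P-gcd step P-j₀ = <-rec Goal descend j₀ ∣-refl P-j₀
  where
  Goal : ℕ → Set _
  Goal j = j ∣ j₀ → P j → ∃[ d ] d ∣ j₀ × P d × Q d

  descend : ∀ j → (∀ {i} → i < j → Goal i) → Goal j
  descend j rec j∣j₀ P-j with step j∣j₀ P-j
  ... | inj₁ Q-j = j , j∣j₀ , P-j , Q-j
  ... | inj₂ (i , P-i , j∤i) =
    rec gcd<j (∣-trans (gcd[m,n]∣m j i) j∣j₀) (P-gcd P-j P-i)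
    where
    instance _ = ≢-nonZero (λ j≡0 → ≢-nonZero⁻¹ j₀ (0∣⇒≡0 (subst (_∣ j₀) j≡0 j∣j₀)))
    gcd<j : gcd j i < j
    gcd<j = ≤∧≢⇒< (∣⇒≤ (gcd[m,n]∣m j i)) (λ g≡j → j∤i (subst (_∣ i) g≡j (gcd[m,n]∣n j i)))

∑-𝟙≟ : ∀ {N} (a : Fin N) (h : Fin N → ℕ) → sum (λ s → 𝟙 (a Fin.≟ s) * h s) ≡ h a
∑-𝟙≟ {suc N} Fin.zero    h = trans (cong₂ _+_ (+-identityʳ (h Fin.zero)) (sum-replicate-zero N)) (+-identityʳ _)
∑-𝟙≟ {suc N} (Fin.suc a) h = ∑-𝟙≟ a (h ∘ Fin.suc)

∑-*-𝟙≟ : ∀ {N} (a : Fin N) (h : Fin N → ℕ) → sum (λ s → h s * 𝟙 (s Fin.≟ a)) ≡ h a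
∑-*-𝟙≟ a h = trans (sum-cong-≗ (λ s → trans (*-comm (h s) _) (cong (_* h s) (𝟙-≟-sym s)))) (∑-𝟙≟ a h)
  where
  𝟙-≟-sym : ∀ s → 𝟙 (s Fin.≟ a) ≡ 𝟙 (a Fin.≟ s)
  𝟙-≟-sym s = 𝟙-cong (s Fin.≟ a) (a Fin.≟ s) (mk⇔ sym sym)

module _ {q} .{{_ : NonZero q}} where

  +-cong-% : a % q ≡ b % q → c % q ≡ d % q → (a + c) % q ≡ (b + d) % q
  +-cong-% {a} {b} {c} {d} a≡b c≡d =
    trans (%-distribˡ-+ a c q) (trans (cong₂ (λ u v → (u + v) % q) a≡b c≡d) (sym (%-distribˡ-+ b d q)))

  *-cong-% : a % q ≡ b % q → c % q ≡ d % q → (a * c) % q ≡ (b * d) % q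
  *-cong-% {a} {b} {c} {d} a≡b c≡d =
    trans (%-distribˡ-* a c q) (trans (cong₂ (λ u v → (u * v) % q) a≡b c≡d) (sym (%-distribˡ-* b d q)))

  sum-cong-% : ∀ {N} {f g : Fin N → ℕ} → (∀ i → f i % q ≡ g i % q) → sum f % q ≡ sum g % q
  sum-cong-% {zero}  _   = refl
  sum-cong-% {suc N} f≈g = +-cong-% (f≈g Fin.zero) (sum-cong-% (f≈g ∘ Fin.suc))

∑< : (ℕ → ℕ) → ℕ → ℕ
∑< g zero    = 0
∑< g (suc N) = g 0 + ∑< (g ∘ suc) N

∑-toℕ : ∀ N (g : ℕ → ℕ) → sum {N} (g ∘ toℕ) ≡ ∑< g N
∑-toℕ zero    g = refl
∑-toℕ (suc N) g = cong (g 0 +_) (∑-toℕ N (g ∘ suc))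

∑<-+ : ∀ g a b → ∑< g (a + b) ≡ ∑< g a + ∑< (g ∘ (a +_)) b
∑<-+ g zero    b = refl
∑<-+ g (suc a) b = trans (cong (g 0 +_) (∑<-+ (g ∘ suc) a b)) (sym (+-assoc (g 0) _ _))

∑<-cong : ∀ {g h} N → (∀ i → g i ≡ h i) → ∑< g N ≡ ∑< h N
∑<-cong zero    _   = refl
∑<-cong (suc N) g≗h = cong₂ _+_ (g≗h 0) (∑<-cong N (g≗h ∘ suc))

∑<-zero : ∀ g N → (∀ i → i < N → g i ≡ 0) → ∑< g N ≡ 0
∑<-zero g zero    _ = refl
∑<-zero g (suc N) g≡0 = cong₂ _+_ (g≡0 0 z<s) (∑<-zero (g ∘ suc) N (λ i i<N → g≡0 (suc i) (s<s i<N)))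

∑<-multiples : ∀ k c → ∑< (λ i → 𝟙 (suc k ∣? i)) (c * suc k) ≡ c
∑<-multiples k zero    = refl
∑<-multiples k (suc c) = begin
  ∑< multiple? (suc k + c * suc k)                              ≡⟨ ∑<-+ multiple? (suc k) (c * suc k) ⟩
  ∑< multiple? (suc k) + ∑< (multiple? ∘ (suc k +_)) (c * suc k) ≡⟨ cong₂ _+_ one-per-period shift ⟩
  1 + c                                                          ∎
  where
  open ≡-Reasoning
  multiple? : ℕ → ℕ
  multiple? i = 𝟙 (suc k ∣? i)
  one-per-period : ∑< multiple? (suc k) ≡ 1
  one-per-period = cong₂ _+_ (𝟙-yes (suc k ∣? 0) (suc k ∣0))
    (∑<-zero (multiple? ∘ suc) k (λ i i<k → 𝟙-no (suc k ∣? suc i) (λ k+1∣i+1 → <⇒≱ (s<s i<k) (∣⇒≤ k+1∣i+1))))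
  shift : ∑< (multiple? ∘ (suc k +_)) (c * suc k) ≡ c
  shift = trans (∑<-cong (c * suc k) (λ i → 𝟙-cong (suc k ∣? (suc k + i)) (suc k ∣? i)
                  (mk⇔ (λ k∣k+i → ∣m+n∣m⇒∣n k∣k+i ∣-refl) (∣m∣n⇒∣m+n ∣-refl))))
                (∑<-multiples k c)

∣p∣≡∑𝟙∈ : ∀ {N} (p : Subset N) → ∣ p ∣ ≡ sum (λ x → 𝟙 (x ∈? p))
∣p∣≡∑𝟙∈ []            = refl
∣p∣≡∑𝟙∈ (inside ∷ p)  = cong suc (∣p∣≡∑𝟙∈ p)
∣p∣≡∑𝟙∈ (outside ∷ p) = ∣p∣≡∑𝟙∈ p

∣p∣≡n/k : ∀ {n k} .{{_ : NonZero k}} (p : Subset n) → k ∣ n → (∀ x → x ∈ p ⇔ k ∣ toℕ x) → ∣ p ∣ ≡ n / k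
∣p∣≡n/k {n} {k@(suc k′)} p k∣n ∈p⇔ = begin
  ∣ p ∣                           ≡⟨ ∣p∣≡∑𝟙∈ p ⟩
  sum {n} (λ x → 𝟙 (x ∈? p))      ≡⟨ sum-cong-≗ {n} (λ x → 𝟙-cong (x ∈? p) (k ∣? toℕ x) (∈p⇔ x)) ⟩
  sum {n} (λ x → 𝟙 (k ∣? toℕ x))  ≡⟨ ∑-toℕ n (λ i → 𝟙 (k ∣? i)) ⟩
  ∑< (λ i → 𝟙 (k ∣? i)) n         ≡⟨ cong (∑< (λ i → 𝟙 (k ∣? i))) (m/n*n≡m k∣n) ⟨
  ∑< (λ i → 𝟙 (k ∣? i)) (n / k * k) ≡⟨ ∑<-multiples k′ (n / k) ⟩
  n / k                           ∎
  where open ≡-Reasoning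

module ℤₙ-Properties (n : ℕ) .{{_ : NonZero n}} where
  open Zn n

  -- In Defs, 𝟘, x ⊕ y and ⊝ x are by definition ι 0, ι (toℕ x + toℕ y) and ι (n ∸ toℕ x).
  ι : ℕ → ℤₙ
  ι a = fromℕ< (m%n<n a n)

  toℕ-ι : ∀ a → toℕ (ι a) ≡ a % n
  toℕ-ι a = toℕ-fromℕ< (m%n<n a n)

  ι-cong-% : a % n ≡ b % n → ι a ≡ ι b
  ι-cong-% {a} {b} a≡b = toℕ-injective (trans (toℕ-ι a) (trans a≡b (sym (toℕ-ι b))))

  ι-toℕ : ∀ x → ι (toℕ x) ≡ x
  ι-toℕ x = toℕ-injective (trans (toℕ-ι (toℕ x)) (m<n⇒m%n≡m (toℕ<n x)))

  ι-+ : ∀ a b → ι (a + b) ≡ ι a ⊕ ι b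
  ι-+ a b = ι-cong-% (trans (%-distribˡ-+ a b n) (sym (cong₂ (λ u v → (u + v) % n) (toℕ-ι a) (toℕ-ι b))))

  toℕ-𝟘 : toℕ 𝟘 ≡ 0
  toℕ-𝟘 = trans (toℕ-ι 0) (m*n%n≡0 0 n)

  ι≡𝟘⇔∣ : ι a ≡ 𝟘 ⇔ n ∣ a
  ι≡𝟘⇔∣ {a} = mk⇔
    (λ ιa≡𝟘 → m%n≡0⇒n∣m a n (trans (sym (toℕ-ι a)) (trans (cong toℕ ιa≡𝟘) toℕ-𝟘)))
    (λ n∣a → ι-cong-% (trans (n∣m⇒m%n≡0 a n n∣a) (sym (m*n%n≡0 0 n))))

  ⊕-comm : ∀ x y → x ⊕ y ≡ y ⊕ x
  ⊕-comm x y = cong ι (+-comm (toℕ x) (toℕ y))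

  ⊕-assoc : ∀ x y z → (x ⊕ y) ⊕ z ≡ x ⊕ (y ⊕ z)
  ⊕-assoc x y z = begin
    (x ⊕ y) ⊕ z                        ≡⟨ cong ((x ⊕ y) ⊕_) (ι-toℕ z) ⟨
    ι (toℕ x + toℕ y) ⊕ ι (toℕ z)      ≡⟨ ι-+ _ _ ⟨
    ι (toℕ x + toℕ y + toℕ z)          ≡⟨ cong ι (+-assoc (toℕ x) _ _) ⟩
    ι (toℕ x + (toℕ y + toℕ z))        ≡⟨ ι-+ _ _ ⟩
    ι (toℕ x) ⊕ ι (toℕ y + toℕ z)      ≡⟨ cong (_⊕ (y ⊕ z)) (ι-toℕ x) ⟩
    x ⊕ (y ⊕ z)                        ∎
    where open ≡-Reasoning

  ⊕-identityʳ : ∀ x → x ⊕ 𝟘 ≡ x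
  ⊕-identityʳ x = trans (cong (λ z → ι (toℕ x + z)) toℕ-𝟘) (trans (cong ι (+-identityʳ (toℕ x))) (ι-toℕ x))

  ⊕-inverseʳ : ∀ x → x ⊖ x ≡ 𝟘
  ⊕-inverseʳ x = begin
    x ⊕ ⊝ x                     ≡⟨ cong (_⊕ ⊝ x) (ι-toℕ x) ⟨
    ι (toℕ x) ⊕ ι (n ∸ toℕ x)   ≡⟨ ι-+ _ _ ⟨
    ι (toℕ x + (n ∸ toℕ x))     ≡⟨ cong ι (m+[n∸m]≡n (<⇒≤ (toℕ<n x))) ⟩
    ι n                         ≡⟨ Equivalence.from ι≡𝟘⇔∣ ∣-refl ⟩
    𝟘                           ∎
    where open ≡-Reasoning

  ⊕-isAbelianGroup : IsAbelianGroup _≡_ _⊕_ 𝟘 ⊝_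
  ⊕-isAbelianGroup = record
    { isGroup = record
      { isMonoid = record
        { isSemigroup = record { isMagma = record { isEquivalence = isEquivalence ; ∙-cong = cong₂ _⊕_ }
                               ; assoc = ⊕-assoc }
        ; identity = (λ x → trans (⊕-comm 𝟘 x) (⊕-identityʳ x)) , ⊕-identityʳ }
      ; inverse = (λ x → trans (⊕-comm (⊝ x) x) (⊕-inverseʳ x)) , ⊕-inverseʳ
      ; ⁻¹-cong = cong ⊝_ }
    ; comm = ⊕-comm }

  ⊕-abelianGroup : AbelianGroup 0ℓ 0ℓ
  ⊕-abelianGroup = record { isAbelianGroup = ⊕-isAbelianGroup }

  private
    module G = AbelianGroup ⊕-abelianGroup

  open import Algebra.Properties.Group G.group
    using (⁻¹-involutive; ⁻¹-anti-homo-∙; ε⁻¹≈ε; x∙y⁻¹≈ε⇒x≈y; x≈y⇒x∙y⁻¹≈ε; inverseʳ-unique)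
  open import Algebra.Properties.CommutativeSemigroup G.commutativeSemigroup using (xy∙z≈xz∙y)
  open import Algebra.Properties.Monoid.Mult G.monoid public
    using (×-homo-1; ×-homo-+; ×-assocˡ) renaming (_×_ to infixr 8 _·_)
  open import Algebra.Properties.CommutativeMonoid.Mult G.commutativeMonoid public using (×-distrib-+)

  x⊖y⊕y≡x : ∀ x y → x ⊖ y ⊕ y ≡ x
  x⊖y⊕y≡x x y = trans (⊕-assoc x (⊝ y) y) (trans (cong (x ⊕_) (G.inverseˡ y)) (⊕-identityʳ x))

  x⊕y⊖y≡x : ∀ x y → x ⊕ y ⊖ y ≡ x
  x⊕y⊖y≡x x y = trans (⊕-assoc x y (⊝ y)) (trans (cong (x ⊕_) (⊕-inverseʳ y)) (⊕-identityʳ x))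

  ⊝𝟘≡𝟘 : ⊝ 𝟘 ≡ 𝟘
  ⊝𝟘≡𝟘 = ε⁻¹≈ε

  x⊖𝟘≡x : ∀ x → x ⊖ 𝟘 ≡ x
  x⊖𝟘≡x x = trans (cong (x ⊕_) ⊝𝟘≡𝟘) (⊕-identityʳ x)

  x⊖⊝y≡x⊕y : ∀ x y → x ⊖ ⊝ y ≡ x ⊕ y
  x⊖⊝y≡x⊕y x y = cong (x ⊕_) (⁻¹-involutive y)

  x⊖y⊖z≡x⊖z⊖y : ∀ x y z → x ⊖ y ⊖ z ≡ x ⊖ z ⊖ y
  x⊖y⊖z≡x⊖z⊖y x y z = xy∙z≈xz∙y x (⊝ y) (⊝ z)

  x⊖[y⊕z]≡x⊖z⊖y : ∀ x y z → x ⊖ (y ⊕ z) ≡ x ⊖ z ⊖ y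
  x⊖[y⊕z]≡x⊖z⊖y x y z = trans (cong (x ⊕_) (⁻¹-anti-homo-∙ y z)) (sym (⊕-assoc x (⊝ z) (⊝ y)))

  x⊕z⊖y≡x⊖[y⊖z] : ∀ x y z → x ⊕ z ⊖ y ≡ x ⊖ (y ⊖ z)
  x⊕z⊖y≡x⊖[y⊖z] x y z = begin
    x ⊕ z ⊖ y       ≡⟨ cong (_⊖ y) (x⊖⊝y≡x⊕y x z) ⟨
    x ⊖ ⊝ z ⊖ y     ≡⟨ x⊖y⊖z≡x⊖z⊖y x (⊝ z) y ⟩
    x ⊖ y ⊖ ⊝ z     ≡⟨ x⊖[y⊕z]≡x⊖z⊖y x (⊝ z) y ⟨
    x ⊖ (⊝ z ⊕ y)   ≡⟨ cong (x ⊖_) (⊕-comm (⊝ z) y) ⟩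
    x ⊖ (y ⊖ z)     ∎
    where open ≡-Reasoning

  [x⊖z]⊖[y⊖z]≡x⊖y : ∀ x y z → (x ⊖ z) ⊖ (y ⊖ z) ≡ x ⊖ y
  [x⊖z]⊖[y⊖z]≡x⊖y x y z = trans (sym (x⊕z⊖y≡x⊖[y⊖z] (x ⊖ z) y z)) (cong (_⊖ y) (x⊖y⊕y≡x x z))

  x⊖[x⊖y]≡y : ∀ x y → x ⊖ (x ⊖ y) ≡ y
  x⊖[x⊖y]≡y x y = trans (sym (x⊕z⊖y≡x⊖[y⊖z] x x y)) (trans (cong (_⊖ x) (⊕-comm x y)) (x⊕y⊖y≡x y x))

  [u⊕b]⊖[v⊕a]≡u⊕[b⊖a]⊖v : ∀ u v a b → (u ⊕ b) ⊖ (v ⊕ a) ≡ u ⊕ (b ⊖ a) ⊖ v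
  [u⊕b]⊖[v⊕a]≡u⊕[b⊖a]⊖v u v a b = begin
    (u ⊕ b) ⊖ (v ⊕ a)   ≡⟨ x⊖[y⊕z]≡x⊖z⊖y (u ⊕ b) v a ⟩
    u ⊕ b ⊖ a ⊖ v       ≡⟨ cong (_⊖ v) (⊕-assoc u b (⊝ a)) ⟩
    u ⊕ (b ⊖ a) ⊖ v     ∎
    where open ≡-Reasoning

  x⊕y≡𝟘⇒y≡⊝x : ∀ {x y} → x ⊕ y ≡ 𝟘 → y ≡ ⊝ x
  x⊕y≡𝟘⇒y≡⊝x = inverseʳ-unique _ _

  x⊖y≡𝟘⇔x≡y : ∀ {x y} → x ⊖ y ≡ 𝟘 ⇔ x ≡ y
  x⊖y≡𝟘⇔x≡y = mk⇔ (x∙y⁻¹≈ε⇒x≈y _ _) x≈y⇒x∙y⁻¹≈ε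

  𝟘≡x⊖y⇔x≡y : ∀ {x y} → 𝟘 ≡ x ⊖ y ⇔ x ≡ y
  𝟘≡x⊖y⇔x≡y = x⊖y≡𝟘⇔x≡y ⇔-∘ mk⇔ sym sym

  x⊕y≡z⇔x≡z⊖y : ∀ {x y z} → x ⊕ y ≡ z ⇔ x ≡ z ⊖ y
  x⊕y≡z⇔x≡z⊖y {x} {y} = mk⇔ (λ { refl → sym (x⊕y⊖y≡x x y) }) (λ { refl → x⊖y⊕y≡x _ y })

  ι-· : ∀ j a → j · ι a ≡ ι (j * a)
  ι-· zero    a = refl
  ι-· (suc j) a = trans (cong (ι a ⊕_) (ι-· j a)) (sym (ι-+ a (j * a)))

  ·≡𝟘 : ∀ {a b j x} → a * b ≡ n → a ∣ j → b ∣ toℕ x → j · x ≡ 𝟘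
  ·≡𝟘 {a} {b} {j} {x} a*b≡n a∣j b∣x = trans (cong (j ·_) (sym (ι-toℕ x)))
    (trans (ι-· j (toℕ x)) (Equivalence.from ι≡𝟘⇔∣ (subst (_∣ j * toℕ x) a*b≡n (*-pres-∣ a∣j b∣x))))

  ·-difference : ∀ {d} a i b j x → d + b * j ≡ a * i → a · (i · x) ⊖ b · (j · x) ≡ d · x
  ·-difference {d} a i b j x d+bj≡ai = begin
    a · (i · x) ⊖ b · (j · x)              ≡⟨ cong₂ _⊖_ (×-assocˡ x a i) (×-assocˡ x b j) ⟩
    (a * i) · x ⊖ (b * j) · x              ≡⟨ cong (λ c → c · x ⊖ (b * j) · x) d+bj≡ai ⟨
    (d + b * j) · x ⊖ (b * j) · x          ≡⟨ cong (_⊖ (b * j) · x) (×-homo-+ x d (b * j)) ⟩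
    d · x ⊕ (b * j) · x ⊖ (b * j) · x      ≡⟨ x⊕y⊖y≡x (d · x) _ ⟩
    d · x                                  ∎
    where open ≡-Reasoning

  -- Defs' IsSubgroup is for decidable subsets only; TwinConjugate below is a mere predicate.
  record IsSubgroupᴾ {ℓ} (P : ℤₙ → Set ℓ) : Set ℓ where
    field
      𝟘-closed : P 𝟘
      ⊕-closed : ∀ {x y} → P x → P y → P (x ⊕ y)
      ⊝-closed : ∀ {x} → P x → P (⊝ x)

    ·-closed : ∀ j {x} → P x → P (j · x)
    ·-closed zero    _   = 𝟘-closed
    ·-closed (suc j) P-x = ⊕-closed P-x (·-closed j P-x)

    gcd-closed : ∀ {i j x} → P (i · x) → P (j · x) → P (gcd i j · x)
    gcd-closed {i} {j} {x} P-ix P-jx with Bézout.identity (gcd-GCD i j)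
    ... | Bézout.Identity.+- a b eq =
      subst P (·-difference a i b j x eq) (⊕-closed (·-closed a P-ix) (⊝-closed (·-closed b P-jx)))
    ... | Bézout.Identity.-+ a b eq =
      subst P (·-difference b j a i x eq) (⊕-closed (·-closed b P-jx) (⊝-closed (·-closed a P-ix)))

  ∈-isSubgroupᴾ : ∀ {H} → IsSubgroup H → IsSubgroupᴾ (_∈ H)
  ∈-isSubgroupᴾ H-subgroup = record
    { 𝟘-closed = 𝟘∈H ; ⊕-closed = ⊕-closed ; ⊝-closed = ⊝-closed }
    where open IsSubgroup H-subgroup

module Reduction (n d : ℕ) .{{_ : NonZero n}} .{{_ : NonZero d}} (d∣n : d ∣ n) where
  open Zn n
  open ℤₙ-Properties n
  private
    module D = Zn d
    module DP = ℤₙ-Properties d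

  reduce : ℤₙ → D.ℤₙ
  reduce x = DP.ι (toℕ x)

  reduce-ι : ∀ a → reduce (ι a) ≡ DP.ι a
  reduce-ι a = DP.ι-cong-% (trans (cong (_% d) (toℕ-ι a)) (m∣n⇒o%n%m≡o%m d n a d∣n))

  reduce-𝟘 : reduce 𝟘 ≡ D.𝟘
  reduce-𝟘 = reduce-ι 0

  reduce-⊕ : ∀ x y → reduce (x ⊕ y) ≡ reduce x D.⊕ reduce y
  reduce-⊕ x y = trans (reduce-ι (toℕ x + toℕ y)) (DP.ι-+ (toℕ x) (toℕ y))

  reduce-⊝ : ∀ x → reduce (⊝ x) ≡ D.⊝ reduce x
  reduce-⊝ x = DP.x⊕y≡𝟘⇒y≡⊝x (trans (sym (reduce-⊕ x (⊝ x))) (trans (cong reduce (⊕-inverseʳ x)) reduce-𝟘))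

  reduce-⊖ : ∀ x y → reduce (x ⊖ y) ≡ reduce x D.⊖ reduce y
  reduce-⊖ x y = trans (reduce-⊕ x (⊝ y)) (cong (reduce x D.⊕_) (reduce-⊝ y))

  reduce-· : ∀ j x → reduce (j · x) ≡ j DP.· reduce x
  reduce-· zero    x = reduce-𝟘
  reduce-· (suc j) x = trans (reduce-⊕ x (j · x)) (cong (reduce x D.⊕_) (reduce-· j x))

  reduce-⊖-cong : ∀ {u u′ v v′} → reduce u ≡ reduce u′ → reduce v ≡ reduce v′ →
                  reduce (u ⊖ v) ≡ reduce (u′ ⊖ v′)
  reduce-⊖-cong {u} {u′} {v} {v′} u≡u′ v≡v′ =
    trans (reduce-⊖ u v) (trans (cong₂ D._⊖_ u≡u′ v≡v′) (sym (reduce-⊖ u′ v′)))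

  reduce≡𝟘⇔∣ : ∀ {x} → reduce x ≡ D.𝟘 ⇔ d ∣ toℕ x
  reduce≡𝟘⇔∣ = DP.ι≡𝟘⇔∣

  reduce≡⇔∣⊖ : ∀ {x y} → reduce x ≡ reduce y ⇔ d ∣ toℕ (x ⊖ y)
  reduce≡⇔∣⊖ {x} {y} = reduce≡𝟘⇔∣ ⇔-∘
    subst (λ r → reduce x ≡ reduce y ⇔ r ≡ D.𝟘) (sym (reduce-⊖ x y)) (⇔-sym DP.x⊖y≡𝟘⇔x≡y)

  ∣-isSubgroupᴾ : IsSubgroupᴾ (λ x → d ∣ toℕ x)
  ∣-isSubgroupᴾ = record
    { 𝟘-closed = to reduce≡𝟘⇔∣ reduce-𝟘
    ; ⊕-closed = λ {x} {y} d∣x d∣y → to reduce≡𝟘⇔∣ (trans (reduce-⊕ x y)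
        (trans (cong₂ D._⊕_ (from reduce≡𝟘⇔∣ d∣x) (from reduce≡𝟘⇔∣ d∣y)) (DP.⊕-identityʳ D.𝟘)))
    ; ⊝-closed = λ {x} d∣x → to reduce≡𝟘⇔∣
        (trans (reduce-⊝ x) (trans (cong D.⊝_ (from reduce≡𝟘⇔∣ d∣x)) DP.⊝𝟘≡𝟘))
    }
    where open Equivalence

module SubgroupsOfℤₙ (n : ℕ) .{{_ : NonZero n}} where
  open Zn n
  open ℤₙ-Properties n

  ·ι1 : ∀ a → a · ι 1 ≡ ι a
  ·ι1 a = trans (ι-· a 1) (cong ι (*-identityʳ a))

  subgroup-multiples : ∀ {H} → IsSubgroup H → ∃[ k ] k ∣ n × (∀ x → x ∈ H ⇔ k ∣ toℕ x)
  subgroup-multiples {H} H-subgroup with gcd-descent {P = P} {Q} (λ {i} {j} → gcd-closed {i} {j}) step P-n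
    where
    open IsSubgroupᴾ (∈-isSubgroupᴾ H-subgroup)
    P Q : ℕ → Set
    P j = j · ι 1 ∈ H
    Q j = ∀ x → x ∈ H → j ∣ toℕ x
    P-n : P n
    P-n = subst (_∈ H) (sym (trans (·ι1 n) (Equivalence.from ι≡𝟘⇔∣ ∣-refl))) 𝟘-closed
    step : ∀ {j} → j ∣ n → P j → Q j ⊎ ∃[ i ] P i × ¬ j ∣ i
    step {j} _ _ with any? (λ x → x ∈? H ×-dec ¬? (j ∣? toℕ x))
    ... | yes (x , x∈H , j∤x) = inj₂ (toℕ x , subst (_∈ H) (sym (trans (·ι1 (toℕ x)) (ι-toℕ x))) x∈H , j∤x)
    ... | no ∄x = inj₁ (λ x x∈H → decidable-stable (j ∣? toℕ x) (λ j∤x → ∄x (x , x∈H , j∤x)))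
  ... | k , k∣n , k∈H , H⊆k∣ = k , k∣n , λ x → mk⇔ (H⊆k∣ x) (k∣⇒∈H x)
    where
    open IsSubgroupᴾ (∈-isSubgroupᴾ H-subgroup)
    k∣⇒∈H : ∀ x → k ∣ toℕ x → x ∈ H
    k∣⇒∈H x (divides c x≡c*k) = subst (_∈ H) c·k·1≡x (·-closed c k∈H)
      where
      c·k·1≡x : c · (k · ι 1) ≡ x
      c·k·1≡x = trans (×-assocˡ (ι 1) c k) (trans (·ι1 (c * k)) (trans (cong ι (sym x≡c*k)) (ι-toℕ x)))

module PrimeCharacteristic {c ℓ} (R : CommutativeSemiring c ℓ) where
  private module R = CommutativeSemiring R
  open R using (Carrier; _≈_; 0#; 1#; semiring) renaming (_+_ to _+ᴿ_; _*_ to _*ᴿ_)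
  open import Algebra.Properties.Semiring.Mult semiring using (×-homo-1; ×-assocˡ) renaming (_×_ to _·_)
  open import Algebra.Properties.Semiring.Exp semiring using (^-congˡ; ^-assocʳ) renaming (_^_ to _^ᴿ_)
  open import Algebra.Properties.Semiring.Sum semiring using ()
    renaming (sum to ∑ᴿ; sum-cong-≋ to ∑ᴿ-cong; sum-init-last to ∑ᴿ-init-last; sum-replicate-zero to ∑ᴿ-zero)
  open import Algebra.Properties.CommutativeSemiring.Binomial R using (theorem; binomialTerm)
  open import Relation.Binary.Reasoning.Setoid R.setoid

  HasCharacteristic : ℕ → Set _
  HasCharacteristic q = ∀ x → q · x ≈ 0#

  ·≈0 : ∀ {q d} → HasCharacteristic q → q ∣ d → ∀ x → d · x ≈ 0#
  ·≈0 {q} {d} char-q (divides e d≡e*q) x = begin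
    d · x         ≡⟨ cong (_· x) (trans d≡e*q (*-comm e q)) ⟩
    (q * e) · x   ≈⟨ ×-assocˡ x q e ⟨
    q · (e · x)   ≈⟨ char-q (e · x) ⟩
    0#            ∎

  -- Binomial theorem, in which q ∣ q C i kills every term but the two outer ones.
  freshman's-dream : ∀ {q} → Prime q → HasCharacteristic q → ∀ x y → (x +ᴿ y) ^ᴿ q ≈ x ^ᴿ q +ᴿ y ^ᴿ q
  freshman's-dream {zero} q-prime _ _ _ = contradiction refl (≢-nonZero⁻¹ 0 {{prime⇒nonZero q-prime}})
  freshman's-dream {q@(suc q′)} q-prime char-q x y = begin
    (x +ᴿ y) ^ᴿ q
      ≈⟨ theorem q x y ⟩
    term Fin.zero +ᴿ ∑ᴿ (term ∘ Fin.suc)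
      ≈⟨ R.+-congˡ (∑ᴿ-init-last (term ∘ Fin.suc)) ⟩
    term Fin.zero +ᴿ (∑ᴿ (term ∘ Fin.suc ∘ inject₁) +ᴿ term (fromℕ q))
      ≈⟨ R.+-cong first (R.+-cong middle last) ⟩
    y ^ᴿ q +ᴿ (0# +ᴿ x ^ᴿ q)
      ≈⟨ R.trans (R.+-congˡ (R.+-identityˡ _)) (R.+-comm _ _) ⟩
    x ^ᴿ q +ᴿ y ^ᴿ q
      ∎
    where
    term = binomialTerm x y q
    first : term Fin.zero ≈ y ^ᴿ q
    first = R.trans (×-homo-1 _) (R.*-identityˡ _)
    middle : ∑ᴿ (term ∘ Fin.suc ∘ inject₁) ≈ 0#
    middle = R.trans
      (∑ᴿ-cong (λ i → ·≈0 char-q (prime∣pCk q-prime z<s (s<s (subst (_< q′) (sym (toℕ-inject₁ i)) (toℕ<n i)))) _))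
      (∑ᴿ-zero q′)
    last : term (fromℕ q) ≈ x ^ᴿ q
    last = begin
      term (fromℕ q)
        ≡⟨ cong (λ i → (q C i) · (x ^ᴿ i *ᴿ y ^ᴿ (q ∸ i))) (toℕ-fromℕ q) ⟩
      (q C q) · (x ^ᴿ q *ᴿ y ^ᴿ (q ∸ q))
        ≡⟨ cong₂ (λ a b → a · (x ^ᴿ q *ᴿ y ^ᴿ b)) (nCn≡1 q) (n∸n≡0 q) ⟩
      1 · (x ^ᴿ q *ᴿ 1#)
        ≈⟨ R.trans (×-homo-1 _) (R.*-identityʳ _) ⟩
      x ^ᴿ q
        ∎

  0#^≈0# : ∀ q .{{_ : NonZero q}} → 0# ^ᴿ q ≈ 0#
  0#^≈0# (suc q) = R.zeroˡ _

  freshman's-dream-∑ : ∀ {q} → Prime q → HasCharacteristic q →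
              ∀ {N} (v : Vector Carrier N) → ∑ᴿ v ^ᴿ q ≈ ∑ᴿ (λ i → v i ^ᴿ q)
  freshman's-dream-∑ {q} q-prime _ {zero} v = 0#^≈0# q {{prime⇒nonZero q-prime}}
  freshman's-dream-∑ q-prime char-q {suc N} v = R.trans
    (freshman's-dream q-prime char-q (v Fin.zero) (∑ᴿ (v ∘ Fin.suc)))
    (R.+-congˡ (freshman's-dream-∑ q-prime char-q (v ∘ Fin.suc)))

  freshman's-dream-∑-^ : ∀ {q} → Prime q → HasCharacteristic q →
               ∀ f {N} (v : Vector Carrier N) → ∑ᴿ v ^ᴿ (q ^ f) ≈ ∑ᴿ (λ i → v i ^ᴿ (q ^ f))
  freshman's-dream-∑-^ q-prime char-q zero    v = R.trans (R.*-identityʳ _) (∑ᴿ-cong (λ i → R.sym (R.*-identityʳ (v i))))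
  freshman's-dream-∑-^ {q} q-prime char-q (suc f) v = begin
    ∑ᴿ v ^ᴿ (q * q ^ f)                       ≈⟨ ^-assocʳ (∑ᴿ v) q (q ^ f) ⟨
    (∑ᴿ v ^ᴿ q) ^ᴿ (q ^ f)                    ≈⟨ ^-congˡ (q ^ f) (freshman's-dream-∑ q-prime char-q v) ⟩
    ∑ᴿ (λ i → v i ^ᴿ q) ^ᴿ (q ^ f)            ≈⟨ freshman's-dream-∑-^ q-prime char-q f (λ i → v i ^ᴿ q) ⟩
    ∑ᴿ (λ i → (v i ^ᴿ q) ^ᴿ (q ^ f))          ≈⟨ ∑ᴿ-cong (λ i → ^-assocʳ (v i) q (q ^ f)) ⟩
    ∑ᴿ (λ i → v i ^ᴿ (q * q ^ f))             ∎

module GroupAlgebra (n : ℕ) .{{_ : NonZero n}} where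
  open Zn n
  open ℤₙ-Properties n

  ℕ[ℤₙ] : Set
  ℕ[ℤₙ] = ℤₙ → ℕ

  infixl 6 _⊞_
  infixl 7 _⊛_
  infixr 8 _⊛^_

  _⊞_ : ℕ[ℤₙ] → ℕ[ℤₙ] → ℕ[ℤₙ]
  (f ⊞ g) z = f z + g z

  _⊛_ : ℕ[ℤₙ] → ℕ[ℤₙ] → ℕ[ℤₙ]
  (f ⊛ g) z = sum (λ s → f s * g (z ⊖ s))

  𝟎 : ℕ[ℤₙ]
  𝟎 _ = 0

  [_] : ℤₙ → ℕ[ℤₙ]
  [ a ] z = 𝟙 (a Fin.≟ z)

  𝟏 : ℕ[ℤₙ]
  𝟏 = [ 𝟘 ]

  _⊛^_ : ℕ[ℤₙ] → ℕ → ℕ[ℤₙ]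
  f ⊛^ zero  = 𝟏
  f ⊛^ suc j = f ⊛ f ⊛^ j

  sum-translate : ∀ (g : ℕ[ℤₙ]) c → sum g ≡ sum (λ s → g (s ⊕ c))
  sum-translate g c = sum-permute g (permutation (_⊕ c) (_⊖ c) (λ y → x⊖y⊕y≡x y c) (λ x → x⊕y⊖y≡x x c))

  sum-reflect : ∀ (g : ℕ[ℤₙ]) z → sum g ≡ sum (λ s → g (z ⊖ s))
  sum-reflect g z = sum-permute g (permutation (z ⊖_) (z ⊖_) (x⊖[x⊖y]≡y z) (x⊖[x⊖y]≡y z))

  ⊛-comm : ∀ f g z → (f ⊛ g) z ≡ (g ⊛ f) z
  ⊛-comm f g z = trans (sum-reflect _ z)
    (sum-cong-≗ (λ s → trans (cong (λ w → f (z ⊖ s) * g w) (x⊖[x⊖y]≡y z s)) (*-comm (f (z ⊖ s)) (g s))))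

  ⊛-assoc : ∀ f g h z → ((f ⊛ g) ⊛ h) z ≡ (f ⊛ (g ⊛ h)) z
  ⊛-assoc f g h z = begin
    sum (λ s → sum (λ t → f t * g (s ⊖ t)) * h (z ⊖ s))
      ≡⟨ sum-cong-≗ (λ s → *-distribʳ-sum (h (z ⊖ s)) (λ t → f t * g (s ⊖ t))) ⟩
    sum (λ s → sum (λ t → f t * g (s ⊖ t) * h (z ⊖ s)))
      ≡⟨ ∑-comm (λ s t → f t * g (s ⊖ t) * h (z ⊖ s)) ⟩
    sum (λ t → sum (λ s → f t * g (s ⊖ t) * h (z ⊖ s)))
      ≡⟨ sum-cong-≗ (λ t → trans (sum-cong-≗ {n} (λ s → *-assoc (f t) (g (s ⊖ t)) (h (z ⊖ s))))
                                 (sym (*-distribˡ-sum (f t) (λ s → g (s ⊖ t) * h (z ⊖ s))))) ⟩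
    sum (λ t → f t * sum (λ s → g (s ⊖ t) * h (z ⊖ s)))
      ≡⟨ sum-cong-≗ (λ t → cong (f t *_) (sum-translate _ t)) ⟩
    sum (λ t → f t * sum (λ s → g (s ⊕ t ⊖ t) * h (z ⊖ (s ⊕ t))))
      ≡⟨ sum-cong-≗ (λ t → cong (f t *_) (sum-cong-≗ (λ s →
           cong₂ (λ u v → g u * h v) (x⊕y⊖y≡x s t) (x⊖[y⊕z]≡x⊖z⊖y z s t)))) ⟩
    sum (λ t → f t * sum (λ s → g s * h (z ⊖ t ⊖ s)))
      ∎
    where open ≡-Reasoning

  ⊛-identityˡ : ∀ g z → (𝟏 ⊛ g) z ≡ g z
  ⊛-identityˡ g z = trans (∑-𝟙≟ 𝟘 (λ s → g (z ⊖ s))) (cong g (x⊖𝟘≡x z))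

  ⊛-distribʳ : ∀ f g h z → ((g ⊞ h) ⊛ f) z ≡ ((g ⊛ f) ⊞ (h ⊛ f)) z
  ⊛-distribʳ f g h z =
    trans (sum-cong-≗ (λ s → *-distribʳ-+ (f (z ⊖ s)) (g s) (h s))) (∑-distrib-+ (λ s → g s * f (z ⊖ s)) _)

  ⊛-zeroˡ : ∀ g z → (𝟎 ⊛ g) z ≡ 0
  ⊛-zeroˡ g z = sum-replicate-zero n

  [a]⊛[b]≡[a⊕b] : ∀ a b z → ([ a ] ⊛ [ b ]) z ≡ [ a ⊕ b ] z
  [a]⊛[b]≡[a⊕b] a b z = trans (∑-𝟙≟ a (λ s → [ b ] (z ⊖ s)))
    (𝟙-cong (b Fin.≟ z ⊖ a) (a ⊕ b Fin.≟ z)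
      (⇔-sym (subst (λ w → w ≡ z ⇔ b ≡ z ⊖ a) (⊕-comm b a) x⊕y≡z⇔x≡z⊖y)))

  module _ (σ : Permutation′ n) where

    DifferenceInvariant : ℕ[ℤₙ] → Set
    DifferenceInvariant f = ∀ x y → f ((σ ⟨$⟩ʳ y) ⊖ (σ ⟨$⟩ʳ x)) ≡ f (y ⊖ x)

    𝟏-invariant : DifferenceInvariant 𝟏
    𝟏-invariant x y = 𝟙-cong (𝟘 Fin.≟ _) (𝟘 Fin.≟ _) (⇔-sym 𝟘≡x⊖y⇔x≡y ⇔-∘ (σ-injective ⇔-∘ 𝟘≡x⊖y⇔x≡y))
      where
      σ-injective : σ ⟨$⟩ʳ y ≡ σ ⟨$⟩ʳ x ⇔ y ≡ x
      σ-injective = mk⇔ (λ σy≡σx → trans (sym (inverseˡ σ)) (trans (cong (σ ⟨$⟩ˡ_) σy≡σx) (inverseˡ σ)))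
                        (cong (σ ⟨$⟩ʳ_))

    ⊛-invariant : ∀ {f g} → DifferenceInvariant f → DifferenceInvariant g → DifferenceInvariant (f ⊛ g)
    ⊛-invariant {f} {g} f-inv g-inv x y = begin
      sum (λ s → f s * g (σy ⊖ σx ⊖ s))
        ≡⟨ sum-translate _ (⊝ σx) ⟩
      sum (λ s → f (s ⊖ σx) * g (σy ⊖ σx ⊖ (s ⊖ σx)))
        ≡⟨ sum-cong-≗ (λ s → cong (λ w → f (s ⊖ σx) * g w) ([x⊖z]⊖[y⊖z]≡x⊖y σy s σx)) ⟩
      sum (λ s → f (s ⊖ σx) * g (σy ⊖ s))
        ≡⟨ sum-permute _ σ ⟩
      sum (λ s → f ((σ ⟨$⟩ʳ s) ⊖ σx) * g (σy ⊖ (σ ⟨$⟩ʳ s)))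
        ≡⟨ sum-cong-≗ (λ s → cong₂ _*_ (f-inv x s) (g-inv s y)) ⟩
      sum (λ s → f (s ⊖ x) * g (y ⊖ s))
        ≡⟨ sum-translate _ x ⟩
      sum (λ s → f (s ⊕ x ⊖ x) * g (y ⊖ (s ⊕ x)))
        ≡⟨ sum-cong-≗ (λ s → cong₂ (λ u v → f u * g v) (x⊕y⊖y≡x s x) (x⊖[y⊕z]≡x⊖z⊖y y s x)) ⟩
      sum (λ s → f s * g (y ⊖ x ⊖ s))
        ∎
      where
      open ≡-Reasoning
      σx = σ ⟨$⟩ʳ x
      σy = σ ⟨$⟩ʳ y

    ⊛^-invariant : ∀ {f} → DifferenceInvariant f → ∀ j → DifferenceInvariant (f ⊛^ j)
    ⊛^-invariant f-inv zero    = 𝟏-invariant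
    ⊛^-invariant {f} f-inv (suc j) = ⊛-invariant {f} {f ⊛^ j} f-inv (⊛^-invariant f-inv j)

  [a]⊛^j≡[j·a] : ∀ a j z → ([ a ] ⊛^ j) z ≡ [ j · a ] z
  [a]⊛^j≡[j·a] a zero    z = refl
  [a]⊛^j≡[j·a] a (suc j) z = trans (sum-cong-≗ (λ s → cong ([ a ] s *_) ([a]⊛^j≡[j·a] a j (z ⊖ s))))
                                   ([a]⊛[b]≡[a⊕b] a (j · a) z)

  module Modulo (q : ℕ) .{{_ : NonZero q}} where

    infix 4 _≈_
    _≈_ : ℕ[ℤₙ] → ℕ[ℤₙ] → Set
    f ≈ g = ∀ z → f z % q ≡ g z % q

    ≗⇒≈ : ∀ {f g} → (∀ z → f z ≡ g z) → f ≈ g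
    ≗⇒≈ f≗g z = cong (_% q) (f≗g z)

    ≈-isEquivalence : IsEquivalence _≈_
    ≈-isEquivalence = record
      { refl = λ _ → refl ; sym = λ f≈g z → sym (f≈g z) ; trans = λ f≈g g≈h z → trans (f≈g z) (g≈h z) }

    ⊞-cong : ∀ {f f′ g g′} → f ≈ f′ → g ≈ g′ → f ⊞ g ≈ f′ ⊞ g′
    ⊞-cong f≈f′ g≈g′ z = +-cong-% (f≈f′ z) (g≈g′ z)

    ⊛-cong : ∀ {f f′ g g′} → f ≈ f′ → g ≈ g′ → f ⊛ g ≈ f′ ⊛ g′
    ⊛-cong f≈f′ g≈g′ z = sum-cong-% (λ s → *-cong-% (f≈f′ s) (g≈g′ (z ⊖ s)))

    ⊛-isCommutativeSemiring : IsCommutativeSemiring _≈_ _⊞_ _⊛_ 𝟎 𝟏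
    ⊛-isCommutativeSemiring = isCommutativeSemiringˡ record
      { +-isCommutativeMonoid = isCommutativeMonoidˡ record
        { isSemigroup = record
          { isMagma = record { isEquivalence = ≈-isEquivalence ; ∙-cong = ⊞-cong }
          ; assoc = λ f g h → ≗⇒≈ (λ z → +-assoc (f z) (g z) (h z)) }
        ; identityˡ = λ f → ≗⇒≈ (λ z → refl)
        ; comm = λ f g → ≗⇒≈ (λ z → +-comm (f z) (g z)) }
      ; *-isCommutativeMonoid = isCommutativeMonoidˡ record
        { isSemigroup = record
          { isMagma = record { isEquivalence = ≈-isEquivalence ; ∙-cong = ⊛-cong }
          ; assoc = λ f g h → ≗⇒≈ (⊛-assoc f g h) }
        ; identityˡ = λ g → ≗⇒≈ (⊛-identityˡ g)
        ; comm = λ f g → ≗⇒≈ (⊛-comm f g) }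
      ; distribʳ = λ f g h → ≗⇒≈ (⊛-distribʳ f g h)
      ; zeroˡ = λ g → ≗⇒≈ (⊛-zeroˡ g) }

    ℕ[ℤₙ]/q : CommutativeSemiring 0ℓ 0ℓ
    ℕ[ℤₙ]/q = record { isCommutativeSemiring = ⊛-isCommutativeSemiring }

    open CommutativeSemiring ℕ[ℤₙ]/q using (semiring)
    open import Algebra.Properties.Semiring.Mult semiring using () renaming (_×_ to _⋆_)
    open import Algebra.Properties.Semiring.Exp semiring using () renaming (_^_ to _^ᵠ_)
    open import Algebra.Properties.Semiring.Sum semiring using () renaming (sum to ∑ᵠ)
    open PrimeCharacteristic ℕ[ℤₙ]/q using (HasCharacteristic)

    ⋆-eval : ∀ c f z → (c ⋆ f) z ≡ c * f z
    ⋆-eval zero    f z = refl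
    ⋆-eval (suc c) f z = cong (f z +_) (⋆-eval c f z)

    ∑ᵠ-eval : ∀ {N} (v : Vector ℕ[ℤₙ] N) z → ∑ᵠ v z ≡ sum (λ i → v i z)
    ∑ᵠ-eval {zero}  v z = refl
    ∑ᵠ-eval {suc N} v z = cong (v Fin.zero z +_) (∑ᵠ-eval (v ∘ Fin.suc) z)

    ⊛^≡^ᵠ : ∀ f j → f ⊛^ j ≡ f ^ᵠ j
    ⊛^≡^ᵠ f zero    = refl
    ⊛^≡^ᵠ f (suc j) = cong (f ⊛_) (⊛^≡^ᵠ f j)

    characteristic-q : HasCharacteristic q
    characteristic-q f z =
      trans (cong (_% q) (trans (⋆-eval q f z) (*-comm q (f z)))) (trans (m*n%n≡0 (f z) q) (sym (m*n%n≡0 0 q)))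

    module _ (q-prime : Prime q) {T : ℤₙ → Set} (T? : Decidable T) (f : ℕ) {e : ℤₙ}
             (power-shift : ∀ t → T t → (q ^ f) · t ≡ t ⊕ e) where
      open CommutativeSemiring ℕ[ℤₙ]/q using (setoid)
      open import Algebra.Properties.Semiring.Mult semiring using () renaming (×-homo-1 to ⋆-homo-1)
      open import Algebra.Properties.Semiring.Exp semiring using (^-congˡ)
      open import Algebra.Properties.Semiring.Sum semiring using () renaming (sum-cong-≋ to ∑ᵠ-cong)
      open PrimeCharacteristic ℕ[ℤₙ]/q using (freshman's-dream-∑-^; 0#^≈0#)
      open import Relation.Binary.Reasoning.Setoid setoid

      private
        χ : ℕ[ℤₙ]
        χ t = 𝟙 (T? t)
        u = q ^ f
        instance _ = >-nonZero (m^n>0 q f)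

      point-mass-power : ∀ t (T?t : Dec (T t)) → (𝟙 T?t ⋆ [ t ]) ^ᵠ u ≈ 𝟙 T?t ⋆ [ t ⊕ e ]
      point-mass-power t (no _)  = 0#^≈0# u
      point-mass-power t (yes Tt) = begin
        (1 ⋆ [ t ]) ^ᵠ u     ≈⟨ ^-congˡ u (⋆-homo-1 [ t ]) ⟩
        [ t ] ^ᵠ u           ≡⟨ ⊛^≡^ᵠ [ t ] u ⟨
        [ t ] ⊛^ u           ≈⟨ ≗⇒≈ ([a]⊛^j≡[j·a] t u) ⟩
        [ u · t ]            ≡⟨ cong [_] (power-shift t Tt) ⟩
        [ t ⊕ e ]            ≈⟨ ⋆-homo-1 [ t ⊕ e ] ⟨
        1 ⋆ [ t ⊕ e ]        ∎

      -- Modulo q the q^f-th power of χ = ∑ χ t ⋆ [ t ] acts termwise, and (q ^ f) · t = t ⊕ e on T.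
      indicator-power : χ ⊛^ u ≈ (λ z → χ (z ⊖ e))
      indicator-power = begin
        χ ⊛^ u                                ≡⟨ ⊛^≡^ᵠ χ u ⟩
        χ ^ᵠ u                                ≈⟨ ^-congˡ u (≗⇒≈ (λ z → sym (expansion z))) ⟩
        ∑ᵠ {n} (λ t → χ t ⋆ [ t ]) ^ᵠ u       ≈⟨ freshman's-dream-∑-^ q-prime characteristic-q f {n} _ ⟩
        ∑ᵠ {n} (λ t → (χ t ⋆ [ t ]) ^ᵠ u)     ≈⟨ ∑ᵠ-cong (λ t → point-mass-power t (T? t)) ⟩
        ∑ᵠ {n} (λ t → χ t ⋆ [ t ⊕ e ])        ≈⟨ ≗⇒≈ translated-expansion ⟩
        (λ z → χ (z ⊖ e))                     ∎
        where
        expansion : ∀ z → ∑ᵠ {n} (λ t → χ t ⋆ [ t ]) z ≡ χ z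
        expansion z = trans (∑ᵠ-eval {n} _ z) (trans (sum-cong-≗ {n} (λ t → ⋆-eval (χ t) [ t ] z)) (∑-*-𝟙≟ z χ))
        translated-expansion : ∀ z → ∑ᵠ {n} (λ t → χ t ⋆ [ t ⊕ e ]) z ≡ χ (z ⊖ e)
        translated-expansion z = trans (∑ᵠ-eval {n} _ z) (trans (sum-cong-≗ {n} translate) (∑-*-𝟙≟ (z ⊖ e) χ))
          where
          translate : ∀ t → (χ t ⋆ [ t ⊕ e ]) z ≡ χ t * 𝟙 (t Fin.≟ z ⊖ e)
          translate t = trans (⋆-eval (χ t) [ t ⊕ e ] z)
                              (cong (χ t *_) (𝟙-cong (t ⊕ e Fin.≟ z) (t Fin.≟ z ⊖ e) x⊕y≡z⇔x≡z⊖y))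

module CayleyDigraphs (n : ℕ) .{{_ : NonZero n}} where
  open Zn n
  open ℤₙ-Properties n
  open GroupAlgebra n using (module Modulo; DifferenceInvariant; ⊛^-invariant; _⊛^_)

  _⟨⊕⟩_ : (ℤₙ → Set) → ℤₙ → ℤₙ → Set
  (T ⟨⊕⟩ e) t = T (t ⊖ e)

  IsCayleyAut : (ℤₙ → Set) → Permutation′ n → Set
  IsCayleyAut T σ = ∀ x y → T (y ⊖ x) ⇔ T ((σ ⟨$⟩ʳ y) ⊖ (σ ⟨$⟩ʳ x))

  -- The q^f-th convolution power of the indicator of T is σ-invariant, and modulo q it is the indicator of T ⊕ e.
  multiplier-theorem : ∀ {T σ} → Decidable T → IsCayleyAut T σ → ∀ {q} → Prime q → ∀ f {e} →
                       (∀ t → T t → (q ^ f) · t ≡ t ⊕ e) → IsCayleyAut (T ⟨⊕⟩ e) σ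
  multiplier-theorem {T} {σ} T? σ-aut {q} q-prime f {e} power-shift x y =
    𝟙-%-injective (nonTrivial⇒n>1 q {{prime⇒nonTrivial q-prime}}) (T? (y ⊖ x ⊖ e)) (T? (σy ⊖ σx ⊖ e)) (begin
      χ (y ⊖ x ⊖ e) % q          ≡⟨ indicator-power (y ⊖ x) ⟨
      (χ ⊛^ (q ^ f)) (y ⊖ x) % q    ≡⟨ cong (_% q) (⊛^-invariant σ χ-invariant (q ^ f) x y) ⟨
      (χ ⊛^ (q ^ f)) (σy ⊖ σx) % q  ≡⟨ indicator-power (σy ⊖ σx) ⟩
      χ (σy ⊖ σx ⊖ e) % q        ∎)
    where
    open ≡-Reasoning
    instance _ = prime⇒nonZero q-prime
    indicator-power = Modulo.indicator-power q q-prime T? f power-shift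
    σx = σ ⟨$⟩ʳ x
    σy = σ ⟨$⟩ʳ y
    χ : ℤₙ → ℕ
    χ t = 𝟙 (T? t)
    χ-invariant : DifferenceInvariant σ χ
    χ-invariant x y = 𝟙-cong (T? _) (T? _) (⇔-sym (σ-aut x y))

  module _ (T : ℤₙ → Set) (σ : Permutation′ n) where
    open import Relation.Binary.Reasoning.Setoid (⇔-setoid 0ℓ)

    Twins : ℤₙ → ℤₙ → Set
    Twins u v = ∀ w → T (u ⊖ w) ⇔ T (v ⊖ w)

    twins-refl : ∀ {u} → Twins u u
    twins-refl w = ⇔-id _

    twins-sym : ∀ {u v} → Twins u v → Twins v u
    twins-sym u~v w = ⇔-sym (u~v w)

    twins-trans : ∀ {u v w} → Twins u v → Twins v w → Twins u w
    twins-trans u~v v~w x = v~w x ⇔-∘ u~v x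

    twins-translate : ∀ {u v} c → Twins u v → Twins (u ⊕ c) (v ⊕ c)
    twins-translate {u} {v} c u~v w =
      subst₂ (λ a b → T a ⇔ T b) (sym (x⊕z⊖y≡x⊖[y⊖z] u w c)) (sym (x⊕z⊖y≡x⊖[y⊖z] v w c)) (u~v (w ⊖ c))

    conjugate : ℤₙ → ℤₙ → ℤₙ
    conjugate a y = (σ ⟨$⟩ʳ (y ⊕ a)) ⊖ a

    TwinConjugate : ℤₙ → Set
    TwinConjugate a = ∀ y → Twins (σ ⟨$⟩ʳ y) (conjugate a y)

    twinConjugate-isSubgroupᴾ : IsSubgroupᴾ TwinConjugate
    twinConjugate-isSubgroupᴾ = record
      { 𝟘-closed = λ y → subst (Twins (σ ⟨$⟩ʳ y)) (conjugate-𝟘 y) twins-refl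
      ; ⊕-closed = λ {a} {b} a-tc b-tc y →
          twins-trans (a-tc y) (subst (Twins (conjugate a y)) (conjugate-⊕ a b y) (twins-translate (⊝ a) (b-tc (y ⊕ a))))
      ; ⊝-closed = λ {a} a-tc y →
          twins-sym (subst₂ Twins (conjugate-⊝ a y) (conjugate-⊖ a y) (twins-translate a (a-tc (y ⊖ a))))
      }
      where
      conjugate-𝟘 : ∀ y → σ ⟨$⟩ʳ y ≡ conjugate 𝟘 y
      conjugate-𝟘 y = sym (trans (x⊖𝟘≡x _) (cong (σ ⟨$⟩ʳ_) (⊕-identityʳ y)))
      conjugate-⊕ : ∀ a b y → conjugate b (y ⊕ a) ⊖ a ≡ conjugate (a ⊕ b) y
      conjugate-⊕ a b y =
        sym (trans (x⊖[y⊕z]≡x⊖z⊖y _ a b) (cong (λ v → (σ ⟨$⟩ʳ v) ⊖ b ⊖ a) (sym (⊕-assoc y a b))))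
      conjugate-⊝ : ∀ a y → (σ ⟨$⟩ʳ (y ⊖ a)) ⊕ a ≡ conjugate (⊝ a) y
      conjugate-⊝ a y = sym (x⊖⊝y≡x⊕y _ a)
      conjugate-⊖ : ∀ a y → conjugate a (y ⊖ a) ⊕ a ≡ σ ⟨$⟩ʳ y
      conjugate-⊖ a y = trans (x⊖y⊕y≡x _ a) (cong (σ ⟨$⟩ʳ_) (x⊖y⊕y≡x y a))

    aut⇒twinConjugate : IsCayleyAut T σ → ∀ {e} → IsCayleyAut (T ⟨⊕⟩ e) σ → TwinConjugate e
    aut⇒twinConjugate σ-aut {e} σ-aut-e y w = begin
      T ((σ ⟨$⟩ʳ y) ⊖ w)                          ≡⟨ cong (λ v → T ((σ ⟨$⟩ʳ y) ⊖ v)) (inverseʳ σ) ⟨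
      T ((σ ⟨$⟩ʳ y) ⊖ (σ ⟨$⟩ʳ x))                 ≈⟨ σ-aut x y ⟨
      T (y ⊖ x)                                   ≡⟨ cong T y⊕e⊖x⊖e≡y⊖x ⟨
      T (y ⊕ e ⊖ x ⊖ e)                           ≈⟨ σ-aut-e x (y ⊕ e) ⟩
      T ((σ ⟨$⟩ʳ (y ⊕ e)) ⊖ (σ ⟨$⟩ʳ x) ⊖ e)       ≡⟨ cong T (x⊖y⊖z≡x⊖z⊖y _ (σ ⟨$⟩ʳ x) e) ⟩
      T (conjugate e y ⊖ (σ ⟨$⟩ʳ x))              ≡⟨ cong (λ v → T (conjugate e y ⊖ v)) (inverseʳ σ) ⟩
      T (conjugate e y ⊖ w)                       ∎
      where
      x = σ ⟨$⟩ˡ w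
      y⊕e⊖x⊖e≡y⊖x = trans (x⊖y⊖z≡x⊖z⊖y (y ⊕ e) x e) (cong (_⊖ x) (x⊕y⊖y≡x y e))

    twinConjugate⇒aut : IsCayleyAut T σ → ∀ {δ} → TwinConjugate δ →
                        ∀ x y → T (y ⊕ δ ⊖ x) ⇔ T ((σ ⟨$⟩ʳ y) ⊕ δ ⊖ (σ ⟨$⟩ʳ x))
    twinConjugate⇒aut σ-aut {δ} δ-tc x y = begin
      T (y ⊕ δ ⊖ x)                               ≈⟨ σ-aut x (y ⊕ δ) ⟩
      T ((σ ⟨$⟩ʳ (y ⊕ δ)) ⊖ (σ ⟨$⟩ʳ x))           ≡⟨ cong T ([x⊖z]⊖[y⊖z]≡x⊖y _ (σ ⟨$⟩ʳ x) δ) ⟨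
      T (conjugate δ y ⊖ ((σ ⟨$⟩ʳ x) ⊖ δ))        ≈⟨ δ-tc y ((σ ⟨$⟩ʳ x) ⊖ δ) ⟨
      T ((σ ⟨$⟩ʳ y) ⊖ ((σ ⟨$⟩ʳ x) ⊖ δ))           ≡⟨ cong T (x⊕z⊖y≡x⊖[y⊖z] _ (σ ⟨$⟩ʳ x) δ) ⟨
      T ((σ ⟨$⟩ʳ y) ⊕ δ ⊖ (σ ⟨$⟩ʳ x))             ∎

    -- The j with TwinConjugate (j · δ) are closed under gcd and include k. For j ∣ k with j > 1, a prime
    -- p ∣ j is prime to m, so m ∣ p^f ∸ 1 for some f > 0; the multiplier theorem then yields p^f ∸ 1,
    -- which j does not divide.
    twinConjugate-generator : Decidable T → IsCayleyAut T σ →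
      ∀ {m k δ} .{{_ : NonZero m}} .{{_ : NonZero k}} → Coprime m k → k · δ ≡ 𝟘 →
      (∀ {v} → m ∣ v → ∀ t → T t → v · t ≡ v · δ) → TwinConjugate δ
    twinConjugate-generator T? σ-aut {m} {k} {δ} m⊥k k·δ≡𝟘 m·T≡m·δ = subst TwinConjugate (×-homo-1 δ) 1·δ-tc
      where
      open IsSubgroupᴾ twinConjugate-isSubgroupᴾ

      escape : ∀ {j} → j ∣ k → 1 < j → ∃[ i ] TwinConjugate (i · δ) × ¬ j ∣ i
      escape {j} j∣k 1<j with ∃-prime-divisor 1<j
      ... | p , p-prime , p∣j
          with ∃-^≡1-mod {p = p} (λ (i∣m , i∣p) → m⊥k (i∣m , ∣-trans i∣p (∣-trans p∣j j∣k)))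
      ...   | f , 0<f , m∣pᶠ∸1 =
        p ^ f ∸ 1 ,
        aut⇒twinConjugate σ-aut {(p ^ f ∸ 1) · δ} (multiplier-theorem {σ = σ} T? σ-aut p-prime f shift) ,
        j∤pᶠ∸1
        where
        instance _ = prime⇒nonZero p-prime
        1+[pᶠ∸1]≡pᶠ : 1 + (p ^ f ∸ 1) ≡ p ^ f
        1+[pᶠ∸1]≡pᶠ = m+[n∸m]≡n (m^n>0 p f)
        shift : ∀ t → T t → (p ^ f) · t ≡ t ⊕ (p ^ f ∸ 1) · δ
        shift t t∈T = trans (cong (_· t) (sym 1+[pᶠ∸1]≡pᶠ)) (cong (t ⊕_) (m·T≡m·δ m∣pᶠ∸1 t t∈T))
        j∤pᶠ∸1 : ¬ j ∣ p ^ f ∸ 1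
        j∤pᶠ∸1 j∣pᶠ∸1 = prime∤1 p-prime
          (∣m+n∣m⇒∣n (subst (p ∣_) (trans (sym 1+[pᶠ∸1]≡pᶠ) (+-comm 1 _)) (m∣m^n 0<f)) (∣-trans p∣j j∣pᶠ∸1))

      step : ∀ {j} → j ∣ k → TwinConjugate (j · δ) → j ≡ 1 ⊎ ∃[ i ] TwinConjugate (i · δ) × ¬ j ∣ i
      step {j} j∣k _ with j ≟ 1
      ... | yes j≡1 = inj₁ j≡1
      ... | no  j≢1 = inj₂ (escape j∣k (≤∧≢⇒< (n≢0⇒n>0 j≢0) (j≢1 ∘ sym)))
        where j≢0 = λ j≡0 → ≢-nonZero⁻¹ k (0∣⇒≡0 (subst (_∣ k) j≡0 j∣k))

      1·δ-tc : TwinConjugate (1 · δ)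
      1·δ-tc with gcd-descent {P = λ j → TwinConjugate (j · δ)} {Q = _≡ 1}
                   (λ {i} {j} → gcd-closed {i} {j} {δ}) step (subst TwinConjugate (sym k·δ≡𝟘) 𝟘-closed)
      ... | _ , _ , d·δ-tc , refl = d·δ-tc

module Replacement (n : ℕ) .{{_ : NonZero n}} (S H : Subset n) {m k : ℕ} .{{_ : NonZero m}} .{{_ : NonZero k}}
                   (m*k≡n : m * k ≡ n) (m⊥k : Coprime m k) (∈H⇔ : ∀ x → x ∈ H ⇔ k ∣ toℕ x) where
  open Zn n
  open ℤₙ-Properties n
  open CayleyDigraphs n
  open Equivalence using (to; from)

  k∣n : k ∣ n
  k∣n = divides m (sym m*k≡n)

  m∣n : m ∣ n
  m∣n = divides k (trans (sym m*k≡n) (*-comm m k))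

  open Reduction n k k∣n using (reduce; reduce-ι; reduce-𝟘; reduce-⊕; reduce-⊖-cong; reduce-·; reduce≡⇔∣⊖)
  private
    module K = ℤₙ-Properties k
    module K′ = Zn k
    module mℤₙ = IsSubgroupᴾ (Reduction.∣-isSubgroupᴾ n m m∣n)

  ∈Coset⇔ : ∀ x g → x ∈Coset H + g ⇔ reduce x ≡ reduce g
  ∈Coset⇔ x g = ⇔-sym reduce≡⇔∣⊖ ⇔-∘ ∈H⇔ (x ⊖ g)

  -- m is prime to k, so some power of m is 1 modulo k.
  ε-exists : ∃[ ε ] m ∣ toℕ ε × reduce ε ≡ K.ι 1
  ε-exists with ∃-^≡1-mod (Coprimality.sym m⊥k)
  ... | f , 0<f , k∣mᶠ∸1 = ι (m ^ f) ,
    subst (m ∣_) (sym (toℕ-ι (m ^ f))) (%-presˡ-∣ (m∣m^n 0<f) m∣n) ,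
    trans (reduce-ι (m ^ f))
          (K.ι-cong-% (trans (cong (_% k) (sym (m+[n∸m]≡n (m^n>0 m f)))) (%-remove-+ʳ 1 k∣mᶠ∸1)))

  ε : ℤₙ
  ε = proj₁ ε-exists

  -- The paper's f: φ g is the element of H + g lying in mℤₙ.
  φ : ℤₙ → ℤₙ
  φ g = toℕ (reduce g) · ε

  φ-cong : ∀ {g g′} → reduce g ≡ reduce g′ → φ g ≡ φ g′
  φ-cong = cong (λ r → toℕ r · ε)

  φ-reduce : ∀ g → reduce (φ g) ≡ reduce g
  φ-reduce g = begin
    reduce (toℕ (reduce g) · ε)       ≡⟨ reduce-· (toℕ (reduce g)) ε ⟩
    toℕ (reduce g) K.· reduce ε        ≡⟨ cong (toℕ (reduce g) K.·_) (proj₂ (proj₂ ε-exists)) ⟩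
    toℕ (reduce g) K.· K.ι 1           ≡⟨ K.ι-· (toℕ (reduce g)) 1 ⟩
    K.ι (toℕ (reduce g) * 1)           ≡⟨ cong K.ι (*-identityʳ _) ⟩
    K.ι (toℕ (reduce g))               ≡⟨ K.ι-toℕ (reduce g) ⟩
    reduce g                           ∎
    where open ≡-Reasoning

  φ∈mℤₙ : ∀ g → m ∣ toℕ (φ g)
  φ∈mℤₙ g = mℤₙ.·-closed (toℕ (reduce g)) (proj₁ (proj₂ ε-exists))

  cosetFun : CosetFun H
  cosetFun = record
    { f = φ
    ; well-defined = λ g g′ g′∈g → φ-cong (sym (to (∈Coset⇔ g′ g) g′∈g))
    ; f-H = cong (_· ε) (trans (cong toℕ reduce-𝟘) K.toℕ-𝟘)
    ; f-in = λ g → from (∈Coset⇔ (φ g) g) (φ-reduce g)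
    }

  ·-coset-invariant : ∀ {v t u} → m ∣ v → reduce t ≡ reduce u → v · t ≡ v · u
  ·-coset-invariant {v} {t} {u} m∣v t≡u = begin
    v · t                    ≡⟨ cong (v ·_) (x⊖y⊕y≡x t u) ⟨
    v · (t ⊖ u ⊕ u)          ≡⟨ ×-distrib-+ (t ⊖ u) u v ⟩
    v · (t ⊖ u) ⊕ v · u      ≡⟨ cong (_⊕ v · u) (·≡𝟘 m*k≡n m∣v (to reduce≡⇔∣⊖ t≡u)) ⟩
    𝟘 ⊕ v · u                ≡⟨ ⊕-comm 𝟘 _ ⟩
    v · u ⊕ 𝟘                ≡⟨ ⊕-identityʳ _ ⟩
    v · u                    ∎
    where open ≡-Reasoning

  replace : (ℤₙ → ℤₙ) → ℤₙ → ℤₙ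
  replace ρ x = ρ (x ⊖ φ x) ⊕ φ x

  module _ {ρ : ℤₙ → ℤₙ} (ρ-reduce : ∀ x → reduce (ρ x) ≡ reduce x) where

    replace-reduce : ∀ x → reduce (replace ρ x) ≡ reduce x
    replace-reduce x = begin
      reduce (ρ (x ⊖ φ x) ⊕ φ x)              ≡⟨ reduce-⊕ _ (φ x) ⟩
      reduce (ρ (x ⊖ φ x)) K′.⊕ reduce (φ x)  ≡⟨ cong (K′._⊕ reduce (φ x)) (ρ-reduce (x ⊖ φ x)) ⟩
      reduce (x ⊖ φ x) K′.⊕ reduce (φ x)      ≡⟨ reduce-⊕ _ (φ x) ⟨
      reduce (x ⊖ φ x ⊕ φ x)                  ≡⟨ cong reduce (x⊖y⊕y≡x x (φ x)) ⟩
      reduce x                                ∎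
      where open ≡-Reasoning

    replace-inverse : ∀ {ρ′} → (∀ x → ρ′ (ρ x) ≡ x) → ∀ x → replace ρ′ (replace ρ x) ≡ x
    replace-inverse {ρ′} ρ′∘ρ≗id x = begin
      ρ′ (replace ρ x ⊖ φ (replace ρ x)) ⊕ φ (replace ρ x)
        ≡⟨ cong (λ a → ρ′ (replace ρ x ⊖ a) ⊕ a) (φ-cong (replace-reduce x)) ⟩
      ρ′ (ρ (x ⊖ φ x) ⊕ φ x ⊖ φ x) ⊕ φ x
        ≡⟨ cong (λ z → ρ′ z ⊕ φ x) (x⊕y⊖y≡x _ (φ x)) ⟩
      ρ′ (ρ (x ⊖ φ x)) ⊕ φ x
        ≡⟨ cong (_⊕ φ x) (ρ′∘ρ≗id (x ⊖ φ x)) ⟩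
      x ⊖ φ x ⊕ φ x
        ≡⟨ x⊖y⊕y≡x x (φ x) ⟩
      x
        ∎
      where open ≡-Reasoning

  module _ (σ : Permutation′ n) (σ∈Autℋ : IsAutℋ S H σ) where
    private
      σ-aut = proj₁ σ∈Autℋ
      σ-fixes = proj₂ σ∈Autℋ

    σ-reduce : ∀ x → reduce (σ ⟨$⟩ʳ x) ≡ reduce x
    σ-reduce x = to (∈Coset⇔ _ x) (proj₁ (σ-fixes x) x (from (∈Coset⇔ x x) refl))

    σ⁻¹-reduce : ∀ y → reduce (σ ⟨$⟩ˡ y) ≡ reduce y
    σ⁻¹-reduce y = sym (trans (cong reduce (sym (inverseʳ σ))) (σ-reduce (σ ⟨$⟩ˡ y)))

    σ̃ : Permutation′ n
    σ̃ = permutation (replace (σ ⟨$⟩ʳ_)) (replace (σ ⟨$⟩ˡ_))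
          (replace-inverse σ⁻¹-reduce {σ ⟨$⟩ʳ_} (λ _ → inverseʳ σ))
          (replace-inverse σ-reduce {σ ⟨$⟩ˡ_} (λ _ → inverseˡ σ))

    σ̃-fixesCosets : FixesCosets H σ̃
    σ̃-fixesCosets g =
      (λ x x∈g → from (∈Coset⇔ _ g) (trans (replace-reduce σ-reduce x) (to (∈Coset⇔ x g) x∈g))) ,
      (λ y y∈g → σ̃ ⟨$⟩ˡ y ,
                 from (∈Coset⇔ _ g) (trans (replace-reduce σ⁻¹-reduce y) (to (∈Coset⇔ y g) y∈g)) ,
                 inverseʳ σ̃)

    σ̃-aut : IsAut S σ̃
    σ̃-aut x y = begin
      (y ⊖ x) ∈ S                           ≈⟨ S⇔T (reduce-⊖-cong (sym (φ-reduce y)) (sym (φ-reduce x))) ⟩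
      T (y ⊖ x)                             ≡⟨ cong T decompose ⟩
      T (y′ ⊕ δ ⊖ x′)                       ≈⟨ twinConjugate⇒aut T σ σ-autᵀ δ-tc x′ y′ ⟩
      T ((σ ⟨$⟩ʳ y′) ⊕ δ ⊖ (σ ⟨$⟩ʳ x′))     ≡⟨ cong T ([u⊕b]⊖[v⊕a]≡u⊕[b⊖a]⊖v _ _ (φ x) (φ y)) ⟨
      T ((σ̃ ⟨$⟩ʳ y) ⊖ (σ̃ ⟨$⟩ʳ x))         ≈⟨ S⇔T (reduce-⊖-cong (σ̃-reduce y) (σ̃-reduce x)) ⟨
      ((σ̃ ⟨$⟩ʳ y) ⊖ (σ̃ ⟨$⟩ʳ x)) ∈ S        ∎
      where
      open import Relation.Binary.Reasoning.Setoid (⇔-setoid 0ℓ)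
      δ = φ y ⊖ φ x
      x′ = x ⊖ φ x
      y′ = y ⊖ φ y

      T : ℤₙ → Set
      T t = t ∈ S × reduce t ≡ reduce δ

      σ̃-reduce : ∀ u → reduce (σ̃ ⟨$⟩ʳ u) ≡ reduce (φ u)
      σ̃-reduce u = trans (replace-reduce σ-reduce u) (sym (φ-reduce u))

      S⇔T : ∀ {t} → reduce t ≡ reduce δ → t ∈ S ⇔ T t
      S⇔T t≡δ = mk⇔ (_, t≡δ) proj₁

      σ-autᵀ : IsCayleyAut T σ
      σ-autᵀ u v = σ-aut u v ×-⇔ mk⇔ (trans σ-diff) (trans (sym σ-diff))
        where σ-diff = reduce-⊖-cong (σ-reduce v) (σ-reduce u)

      δ-tc : TwinConjugate T σ δ
      δ-tc = twinConjugate-generator T σ (λ t → (t ∈? S) ×-dec (reduce t Fin.≟ reduce δ)) σ-autᵀ m⊥k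
        (·≡𝟘 {k} {m} (trans (*-comm k m) m*k≡n) ∣-refl (mℤₙ.⊕-closed (φ∈mℤₙ y) (mℤₙ.⊝-closed (φ∈mℤₙ x))))
        (λ m∣v t (_ , t≡δ) → ·-coset-invariant m∣v t≡δ)

      decompose : y ⊖ x ≡ y′ ⊕ δ ⊖ x′
      decompose = trans (cong₂ _⊖_ (sym (x⊖y⊕y≡x y (φ y))) (sym (x⊖y⊕y≡x x (φ x))))
                        ([u⊕b]⊖[v⊕a]≡u⊕[b⊖a]⊖v y′ x′ (φ x) (φ y))

  replacementProperty : ReplacementProperty S H
  replacementProperty = cosetFun , λ σ σ∈Autℋ → σ̃ σ σ∈Autℋ , (σ̃-aut σ σ∈Autℋ , σ̃-fixesCosets σ σ∈Autℋ) ,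
    λ g x x∈g → cong (λ a → (σ ⟨$⟩ʳ (x ⊖ a)) ⊕ a) (φ-cong (to (∈Coset⇔ x g) x∈g))

theorem1p1 : (n : ℕ) .{{nz : NonZero n}} (S H : Subset n)
    → (∀ x → x ∈ S → Zn.⊝_ n x ∈ S)
    → Zn.𝟘 n ∉ S
    → (sg : Zn.IsSubgroup n H)
    → gcd ∣ H ∣ (index n H sg) ≡ 1
    → Zn.ReplacementProperty n S H
theorem1p1 n S H _ _ H-subgroup gcd[∣H∣,index]≡1 with SubgroupsOfℤₙ.subgroup-multiples n H-subgroup
... | k , k∣n , ∈H⇔ = Replacement.replacementProperty n S H n/k*k≡n n/k⊥k ∈H⇔
  where
  instance
    k≢0 : NonZero k
    k≢0 = ≢-nonZero (λ k≡0 → ≢-nonZero⁻¹ n (0∣⇒≡0 (subst (_∣ n) k≡0 k∣n)))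
  n/k*k≡n : n / k * k ≡ n
  n/k*k≡n = m/n*n≡m k∣n
  instance
    n/k≢0 : NonZero (n / k)
    n/k≢0 = ≢-nonZero (λ n/k≡0 → ≢-nonZero⁻¹ n (trans (sym n/k*k≡n) (cong (_* k) n/k≡0)))
  ∣H∣≡n/k : ∣ H ∣ ≡ n / k
  ∣H∣≡n/k = ∣p∣≡n/k H k∣n ∈H⇔
  index≡k : index n H H-subgroup ≡ k
  index≡k = trans (/-congʳ {{∈⇒NonZero (Zn.IsSubgroup.𝟘∈H H-subgroup)}} ∣H∣≡n/k)
                  (trans (/-congˡ {o = n / k} (trans (sym n/k*k≡n) (*-comm (n / k) k))) (m*n/n≡m k (n / k)))
  n/k⊥k : Coprime (n / k) k
  n/k⊥k = Coprimality.gcd≡1⇒coprime (subst₂ (λ a b → gcd a b ≡ 1) ∣H∣≡n/k index≡k gcd[∣H∣,index]≡1)
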